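{- Let $G=(V,E_\mathrm{D}\cup E_\mathrm{U})$ be an acyclic mixed graph with $n$ vertices and let $P\subseteq V\times V$ be a set of requests such that for every $(s,t)\in P$ there is a path from $s$ to $t$ in $G$. Run the following Greedy Orientation algorithm. (1) For each request $(s_i,t_i)\in P$ let $p_i$ be a shortest path from $s_i$ to $t_i$ in $G$, and let $\mathcal{P}$ be the collection of these paths. (2) While some $p_i\in\mathcal{P}$ is in conflict with fewer than $(n|P|)^{1/3}$ paths of $\mathcal{P}$: let $\mathcal{Q}\subseteq\mathcal{P}$ be the set of paths in conflict with $p_i$, orient the (undirected) edges of $p_i$ in $G$ from $s_i$ towards $t_i$, and set $\mathcal{P}\leftarrow\mathcal{P}\setminus(\mathcal{Q}\cup\{p_i\})$. (3) Let $v$ be a vertex contained in a maximum number of paths of $\mathcal{P}$, and let $\mathcal{P}_v\subseteq\mathcal{P}$ be the set of those paths. (4) Apply to the current mixed graph $G$, the vertex $v$ and the requests of $\mathcal{P}_v$ (with their paths) an algorithm $\mathcal{A}$ which, for some fixed absolute constant $c_0>0$, given any acyclic mixed graph $H$, a vertex $v$ and a set $Q$ of requests each associated with a shortest path in $H$ through $v$, returns an orientation of $H$ satisfying at least $c_0|Q|$ of these requests; return the resulting orientation. Then the returned orientation satisfies $\Omega\big(|P|/(n|P|)^{1/3}\big)$ of the requests in $P$.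
   Context: A mixed graph has a set $E_\mathrm{D}$ of directed edges and a set $E_\mathrm{U}$ of undirected edges. An orientation of $G$ is the directed graph obtained by choosing a single direction for each undirected edge, keeping directed edges unchanged; orienting some undirected edges of a mixed graph yields again a mixed graph. A request $(s,t)$ is satisfied if the orientation contains a directed path from $s$ to $t$. A path from $s$ to $t$ in $G$ is a sequence of distinct vertices from $s$ to $t$ in which consecutive vertices are joined by an undirected edge or by a directed edge pointing forward; a shortest path minimizes the number of edges (ties broken arbitrarily). $G$ is acyclic if it has no cycle that can be traversed using undirected edges in either direction and directed edges only in their own direction. Two paths $p_1,p_2$ are in conflict if they share an undirected edge that receives different directions when the edges of $p_1$ are oriented consistently from its source to its target and the edges of $p_2$ are oriented consistently from its source to its target. $\Omega(\cdot)$ hides an absolute positive constant. (Such an algorithm $\mathcal{A}$ exists and runs in polynomial time.) -}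

module Defs where

open import Data.Nat using (ℕ; _+_; _*_; _^_; _≤_; _<_)
open import Data.Bool using (Bool; true; false)
open import Data.Fin using (Fin)
open import Data.Fin.Subset using (Subset; _∈_; ∣_∣; _─_; _∪_; ⁅_⁆)
open import Data.List using (List; []; _∷_; map; length)
open import Data.List.Relation.Unary.Unique.Propositional using (Unique)
open import Data.List.Membership.Propositional using () renaming (_∈_ to _∈ₗ_)
open import Data.Product using (Σ; ∃; _×_; _,_; proj₁; proj₂)
open import Data.Sum using (_⊎_)
open import Relation.Nullary using (¬_)
open import Relation.Binary.PropositionalEquality using (_≡_; _≢_)
open import Function.Definitions using (Injective)

-- If directed e ≡ true it is the arc
-- tail e → head e; otherwise it is the undirected edge {tail e, head e}
-- (the labels tail/head of an undirected edge carry no meaning).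

record MixedGraph (n m : ℕ) : Set where
  field
    tail     : Fin m → Fin n
    head     : Fin m → Fin n
    directed : Fin m → Bool
open MixedGraph public

-- No two "equal" edges (the edge sets E_D, E_U are sets).
Simple : ∀ {n m} → MixedGraph n m → Set
Simple {m = m} G = (e e' : Fin m) → e ≢ e' →
    ¬ (tail G e ≡ tail G e' × head G e ≡ head G e' × directed G e ≡ directed G e')
  × ¬ (directed G e ≡ false × directed G e' ≡ false × tail G e ≡ head G e' × head G e ≡ tail G e')

Step : ∀ {n m} → MixedGraph n m → Fin m → Fin n → Fin n → Set
Step G e x y = (tail G e ≡ x × head G e ≡ y)
             ⊎ (directed G e ≡ false × tail G e ≡ y × head G e ≡ x)

-- A traversal (e , x , y): edge e used from x to y.
Trav : ℕ → ℕ → Set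
Trav n m = Fin m × Fin n × Fin n

trEdge : ∀ {n m} → Trav n m → Fin m
trEdge = proj₁

trTo : ∀ {n m} → Trav n m → Fin n
trTo t = proj₂ (proj₂ t)

IsWalk : ∀ {n m} → MixedGraph n m → Fin n → Fin n → List (Trav n m) → Set
IsWalk G s t [] = s ≡ t
IsWalk G s t ((e , x , y) ∷ ts) = s ≡ x × Step G e x y × IsWalk G y t ts

verts : ∀ {n m} → Fin n → List (Trav n m) → List (Fin n)
verts s ts = s ∷ map trTo ts

IsPath : ∀ {n m} → MixedGraph n m → Fin n → Fin n → List (Trav n m) → Set
IsPath G s t ts = IsWalk G s t ts × Unique (verts s ts)

Request : ℕ → Set
Request n = Fin n × Fin n

IsShortestPath : ∀ {n m} → MixedGraph n m → Request n → List (Trav n m) → Set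
IsShortestPath G (s , t) ts =
  IsPath G s t ts × (∀ ts' → IsPath G s t ts' → length ts ≤ length ts')

IsCycle : ∀ {n m} → MixedGraph n m → Fin n → List (Trav n m) → Set
IsCycle G x ts = ts ≢ [] × IsWalk G x x ts × Unique (map trEdge ts) × Unique (map trTo ts)

Acyclic : ∀ {n m} → MixedGraph n m → Set
Acyclic G = ∀ x ts → ¬ IsCycle G x ts

IsOrientation : ∀ {n m} → MixedGraph n m → MixedGraph n m → Set
IsOrientation {m = m} H O = (e : Fin m) → directed O e ≡ true ×
  ((tail O e ≡ tail H e × head O e ≡ head H e)
   ⊎ (directed H e ≡ false × tail O e ≡ head H e × head O e ≡ tail H e))

Satisfies : ∀ {n m} → MixedGraph n m → Request n → Set
Satisfies O (s , t) = ∃ λ ts → IsPath O s t ts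

Conflict : ∀ {n m} → MixedGraph n m → List (Trav n m) → List (Trav n m) → Set
Conflict H p q = ∃ λ e → ∃ λ x → ∃ λ y →
  directed H e ≡ false × (e , x , y) ∈ₗ p × (e , y , x) ∈ₗ q

OrientAlong : ∀ {n m} → MixedGraph n m → List (Trav n m) → MixedGraph n m → Set
OrientAlong {m = m} H p H' = (e : Fin m) →
    (∀ x y → (e , x , y) ∈ₗ p → directed H e ≡ false →
       tail H' e ≡ x × head H' e ≡ y × directed H' e ≡ true)
  × (¬ (∃ λ x → ∃ λ y → (e , x , y) ∈ₗ p × directed H e ≡ false) →
       tail H' e ≡ tail H e × head H' e ≡ head H e × directed H' e ≡ directed H e)

_⇔_ : Set → Set → Set
A ⇔ B = (A → B) × (B → A)

-- Algorithm 𝒜 with guarantee c₀ = a / b : given an acyclic mixed graph H,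
-- a vertex v and a set Q of q requests each with a shortest path in H
-- through v, it returns an orientation of H satisfying ≥ c₀·q of them.

AlgA : ℕ → ℕ → Set
AlgA n m = MixedGraph n m → Fin n → (q : ℕ) → (Fin q → Request n × List (Trav n m)) → MixedGraph n m

AlgSpec : ℕ → ℕ → ∀ {n m} → AlgA n m → Set
AlgSpec a b {n} {m} 𝒜 = (H : MixedGraph n m) (v : Fin n) (q : ℕ)
  (Q : Fin q → Request n × List (Trav n m)) →
  Acyclic H → Injective _≡_ _≡_ (λ j → proj₁ (Q j)) →
  (∀ j → IsShortestPath H (proj₁ (Q j)) (proj₂ (Q j))
         × v ∈ₗ verts (proj₁ (proj₁ (Q j))) (proj₂ (Q j))) →
  IsOrientation H (𝒜 H v q Q)
  × Σ (Subset q) λ S → (∀ j → j ∈ S → Satisfies (𝒜 H v q Q) (proj₁ (Q j)))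
                       × a * q ≤ b * ∣ S ∣

module Greedy {n m k : ℕ} (req : Fin k → Request n)
              (paths : Fin k → List (Trav n m)) where

  IsConflictSet : MixedGraph n m → Subset k → Fin k → Subset k → Set
  IsConflictSet H A i C = ∀ j → (j ∈ C) ⇔ (j ∈ A × Conflict H (paths i) (paths j))

  -- Loop H A Hf Af : the while-loop (step 2), started with current graph H
  -- and current collection A, can end with graph Hf and collection Af.
  -- "fewer than (n|P|)^{1/3}" for a count c is  c ^ 3 < n * k.
  data Loop (H : MixedGraph n m) (A : Subset k) : MixedGraph n m → Subset k → Set where
    done : (∀ i C → i ∈ A → IsConflictSet H A i C → ¬ (∣ C ∣ ^ 3 < n * k)) →
           Loop H A H A
    step : ∀ {Hf Af} (i : Fin k) (C : Subset k) (H' : MixedGraph n m) →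
           i ∈ A → IsConflictSet H A i C → ∣ C ∣ ^ 3 < n * k →
           OrientAlong H (paths i) H' →
           Loop H' (A ─ (C ∪ ⁅ i ⁆)) Hf Af →
           Loop H A Hf Af

  IsThrough : Subset k → Fin n → Subset k → Set
  IsThrough A v S = ∀ j → (j ∈ S) ⇔ (j ∈ A × v ∈ₗ verts (proj₁ (req j)) (paths j))

-- Let N = n|P| and x = ⌈N^(1/3)⌉. Each iteration of the loop orients a whole path, whose edges then
-- stay directed, so its request is satisfied by the final orientation, and discards |C| + 1 ≤ x paths.
-- Hence |P| ≤ |A| + |T| x for the set A of surviving paths and the set T of paths oriented by the loop.
-- When the loop stops, every survivor conflicts with at least x survivors, each passing through one of
-- its vertices, so double counting gives |A| x ≤ n D², where D is the maximum number of survivors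
-- through a vertex. If |P| > 2|A| then |P| ≤ 2|T| x and |P|³ ≤ 64 |T|³ N; otherwise |P| x ≤ 2 n D²
-- and N ≤ x³ give |P|⁴ ≤ 8 n² D⁶, so |P|³ ≤ 3 D³ N. Finally 𝒜 satisfies a fraction a/b of the D
-- survivors through v (still shortest paths, as the loop only orients edges), whence |P|³ ≤ 64 b³ |S|³ N
-- for the set S of satisfied requests.

module Submission where

open import Defs
open import Data.Bool using (true; false; if_then_else_)
import Data.Bool.Properties as Bool
open import Data.Fin using (Fin; zero; suc)
import Data.Fin.Properties as Fin
open import Data.Fin.Subset
  using (Subset; _∈_; _∉_; _⊆_; ∣_∣; _∪_; _─_; ⁅_⁆; ⊤; ⊥; inside; outside)
open import Data.Fin.Subset.Properties
  using (_∈?_; ∈⊤; ∉⊥; ∣⊤∣≡n; ∣⊥∣≡0; ∣⁅x⁆∣≡1; ∪-identityʳ; x∈⁅x⁆; x∈⁅y⁆⇒x≡y; x∈p∪q⁺; x∈p∪q⁻;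
         p─q⊆p; ∣p∣≤∣p∪q∣; ∣q∣≤∣p∪q∣; p⊆q⇒∣p∣≤∣q∣)
open import Data.List using (List; []; _∷_)
open import Data.List.Membership.Propositional using (find; lose) renaming (_∈_ to _∈ₗ_)
open import Data.List.Membership.Propositional.Properties using (∈-map⁺)
import Data.List.Membership.DecPropositional as DecMembership
open import Data.List.Relation.Unary.Any using (here; there; any?)
open import Data.Nat
open import Data.Nat.Properties
open import Algebra.Properties.Semiring.Sum +-*-semiring
  using (sum; sum-cong-≗; ∑-comm; *-distribˡ-sum; *-distribʳ-sum)
open import Data.Nat.Tactic.RingSolver using (solve-∀)
open import Data.Product using (Σ; ∃; ∃₂; _×_; _,_; proj₁; proj₂)
open import Data.Product.Properties using (≡-dec)
open import Data.Sum using (_⊎_; inj₁; inj₂)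
open import Data.Vec using (_∷_; []; tabulate; lookup; here; there)
open import Data.Vec.Functional using (Vector)
open import Data.Vec.Properties using (lookup⇒[]=; []=⇒lookup; lookup∘tabulate)
open import Function using (_∘_; _∘′_)
open import Function.Definitions using (Injective)
open import Relation.Binary.PropositionalEquality
open import Relation.Nullary using (Dec; yes; no; does; ¬_; contradiction)
open import Relation.Nullary.Decidable using (dec-true; _×-dec_)
open import Relation.Unary using (Pred; Decidable)

-- Arithmetic

least-upwardClosed : ∀ {p} {P : Pred ℕ p} → Decidable P → (∀ {x y} → x ≤ y → P x → P y) →
                     ∀ {b} → P b → Σ ℕ λ x → P x × (∀ y → P y → x ≤ y)
least-upwardClosed P? up {zero} Pb = 0 , Pb , λ _ _ → z≤n
least-upwardClosed P? up {suc b} Pb with P? b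
... | yes Pb′ = least-upwardClosed P? up Pb′
... | no ¬Pb′ = suc b , Pb , λ y Py → ≰⇒> (λ y≤b → ¬Pb′ (up y≤b Py))

m≤m^3 : ∀ m → m ≤ m ^ 3
m≤m^3 zero    = z≤n
m≤m^3 (suc m) = m≤m*n (suc m) (suc m ^ 2) {{m^n≢0 (suc m) 2}}

cubeRootCeiling : ∀ N → Σ ℕ λ x → N ≤ x ^ 3 × (∀ y → N ≤ y ^ 3 → x ≤ y)
cubeRootCeiling N = least-upwardClosed (λ x → N ≤? x ^ 3)
  (λ x≤y N≤x³ → ≤-trans N≤x³ (^-monoˡ-≤ 3 x≤y)) {N} (m≤m^3 N)

⌈∛_⌉ : ℕ → ℕ
⌈∛ N ⌉ = proj₁ (cubeRootCeiling N)

≤⌈∛⌉^3 : ∀ N → N ≤ ⌈∛ N ⌉ ^ 3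
≤⌈∛⌉^3 N = proj₁ (proj₂ (cubeRootCeiling N))

⌈∛⌉-least : ∀ {N c} → N ≤ c ^ 3 → ⌈∛ N ⌉ ≤ c
⌈∛⌉-least {N} {c} = proj₂ (proj₂ (cubeRootCeiling N)) c

<⌈∛⌉ : ∀ {N c} → c ^ 3 < N → c < ⌈∛ N ⌉
<⌈∛⌉ {N} c³<N = ≰⇒> (λ x≤c → <⇒≱ c³<N (≤-trans (≤⌈∛⌉^3 N) (^-monoˡ-≤ 3 x≤c)))

-- The ring solver rejects _^_, so its identities are stated with powers unfolded.
[1+m]^3≤8*m^3 : ∀ m → 1 ≤ m → suc m ^ 3 ≤ 8 * m ^ 3
[1+m]^3≤8*m^3 m 1≤m = begin
  suc m ^ 3   ≤⟨ ^-monoˡ-≤ 3 (+-monoˡ-≤ m 1≤m) ⟩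
  (m + m) ^ 3 ≡⟨ cube-double m ⟩
  8 * m ^ 3   ∎
  where
  open ≤-Reasoning
  cube-double : ∀ m → (m + m) * ((m + m) * ((m + m) * 1)) ≡ 8 * (m * (m * (m * 1)))
  cube-double = solve-∀

⌈∛⌉^3≤8* : ∀ N → 1 ≤ N → ⌈∛ N ⌉ ^ 3 ≤ 8 * N
⌈∛⌉^3≤8* N 1≤N with ⌈∛ N ⌉ in x≡
... | zero          = z≤n
... | suc zero      = ≤-trans 1≤N (m≤n*m N 8)
... | suc y@(suc _) = ≤-trans ([1+m]^3≤8*m^3 y (s≤s z≤n)) (*-monoʳ-≤ 8 (<⇒≤ y³<N))
  where
  y³<N : y ^ 3 < N
  y³<N = ≰⇒> (λ N≤y³ → 1+n≰n (subst (_≤ y) x≡ (⌈∛⌉-least N≤y³)))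

m≤A+B∧2A<m⇒m≤2B : ∀ {m A B} → m ≤ A + B → ¬ m ≤ 2 * A → m ≤ 2 * B
m≤A+B∧2A<m⇒m≤2B {m} {A} {B} m≤A+B m≰2A = +-cancelˡ-≤ m m (2 * B) (begin
  m + m                 ≤⟨ +-mono-≤ m≤A+B m≤A+B ⟩
  (A + B) + (A + B)     ≡⟨ regroup A B ⟩
  2 * A + 2 * B         ≤⟨ +-monoˡ-≤ (2 * B) (<⇒≤ (≰⇒> m≰2A)) ⟩
  m + 2 * B             ∎)
  where
  open ≤-Reasoning
  regroup : ∀ A B → (A + B) + (A + B) ≡ 2 * A + 2 * B
  regroup = solve-∀

m^2≤8n^2⇒m≤3n : ∀ m n → m ^ 2 ≤ 8 * n ^ 2 → m ≤ 3 * n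
m^2≤8n^2⇒m≤3n m n m²≤8n² = ≮⇒≥ λ 3n<m → <-irrefl refl (begin-strict
  9 * n ^ 2   ≡⟨ square-triple n ⟩
  (3 * n) ^ 2 <⟨ ^-monoˡ-< 2 3n<m ⟩
  m ^ 2       ≤⟨ m²≤8n² ⟩
  8 * n ^ 2   ≤⟨ *-monoˡ-≤ (n ^ 2) (n≤1+n 8) ⟩
  9 * n ^ 2   ∎)
  where
  open ≤-Reasoning
  square-triple : ∀ n → 9 * (n * (n * 1)) ≡ (3 * n) * ((3 * n) * 1)
  square-triple = solve-∀

k^3-bound-fewSurvivors : ∀ {k A T x N} → k ≤ A + T * x → ¬ k ≤ 2 * A → x ^ 3 ≤ 8 * N →
                         k ^ 3 ≤ 64 * T ^ 3 * N
k^3-bound-fewSurvivors {k} {A} {T} {x} {N} k≤A+Tx k≰2A x³≤8N = begin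
  k ^ 3               ≤⟨ ^-monoˡ-≤ 3 (m≤A+B∧2A<m⇒m≤2B {B = T * x} k≤A+Tx k≰2A) ⟩
  (2 * (T * x)) ^ 3   ≡⟨ cube-expand T x ⟩
  8 * T ^ 3 * x ^ 3   ≤⟨ *-monoʳ-≤ (8 * T ^ 3) x³≤8N ⟩
  8 * T ^ 3 * (8 * N) ≡⟨ regroup T N ⟩
  64 * T ^ 3 * N      ∎
  where
  open ≤-Reasoning
  cube-expand : ∀ T x → (2 * (T * x)) * ((2 * (T * x)) * ((2 * (T * x)) * 1))
                        ≡ 8 * (T * (T * (T * 1))) * (x * (x * (x * 1)))
  cube-expand = solve-∀
  regroup : ∀ T N → 8 * (T * (T * (T * 1))) * (8 * N) ≡ 64 * (T * (T * (T * 1))) * N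
  regroup = solve-∀

k^3-bound-manySurvivors : ∀ {k A D x n} .{{_ : NonZero n}} → k ≤ 2 * A → A * x ≤ n * (D * D) →
                          n * k ≤ x ^ 3 → k ^ 3 ≤ 64 * D ^ 3 * (n * k)
k^3-bound-manySurvivors {k} {A} {D} {x} {n} k≤2A Ax≤nD² nk≤x³ = begin
  k ^ 3                   ≡⟨ *-comm k (k ^ 2) ⟩
  k ^ 2 * k               ≤⟨ *-monoˡ-≤ k k²≤3nD³ ⟩
  3 * (n * D ^ 3) * k     ≡⟨ regroup n D k ⟩
  3 * D ^ 3 * (n * k)     ≤⟨ *-monoˡ-≤ (n * k) (*-monoˡ-≤ (D ^ 3) (m≤m+n 3 61)) ⟩
  64 * D ^ 3 * (n * k)    ∎
  where
  open ≤-Reasoning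
  kx≤2nD² : k * x ≤ 2 * (n * (D * D))
  kx≤2nD² = begin
    k * x       ≤⟨ *-monoˡ-≤ x k≤2A ⟩
    2 * A * x   ≡⟨ *-assoc 2 A x ⟩
    2 * (A * x) ≤⟨ *-monoʳ-≤ 2 Ax≤nD² ⟩
    2 * (n * (D * D)) ∎
  nk⁴≤n8[nD³]² : n * (k ^ 2) ^ 2 ≤ n * (8 * (n * D ^ 3) ^ 2)
  nk⁴≤n8[nD³]² = begin
    n * (k ^ 2) ^ 2            ≡⟨ split n k ⟩
    (n * k) * k ^ 3            ≤⟨ *-monoˡ-≤ (k ^ 3) nk≤x³ ⟩
    x ^ 3 * k ^ 3              ≡⟨ merge x k ⟩
    (k * x) ^ 3                ≤⟨ ^-monoˡ-≤ 3 kx≤2nD² ⟩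
    (2 * (n * (D * D))) ^ 3    ≡⟨ expand n D ⟩
    n * (8 * (n * D ^ 3) ^ 2)  ∎
    where
    split : ∀ n k → n * ((k * (k * 1)) * ((k * (k * 1)) * 1)) ≡ (n * k) * (k * (k * (k * 1)))
    split = solve-∀
    merge : ∀ x k → (x * (x * (x * 1))) * (k * (k * (k * 1))) ≡ (k * x) * ((k * x) * ((k * x) * 1))
    merge = solve-∀
    expand : ∀ n D → (2 * (n * (D * D))) * ((2 * (n * (D * D))) * ((2 * (n * (D * D))) * 1))
                     ≡ n * (8 * ((n * (D * (D * (D * 1)))) * ((n * (D * (D * (D * 1)))) * 1)))
    expand = solve-∀
  k²≤3nD³ : k ^ 2 ≤ 3 * (n * D ^ 3)
  k²≤3nD³ = m^2≤8n^2⇒m≤3n (k ^ 2) (n * D ^ 3) (*-cancelˡ-≤ n nk⁴≤n8[nD³]²)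
  regroup : ∀ n D k → 3 * (n * (D * (D * (D * 1)))) * k ≡ 3 * (D * (D * (D * 1))) * (n * k)
  regroup = solve-∀

k^3-bound : ∀ {n k A T D Y} .{{_ : NonZero n}} .{{_ : NonZero k}} →
            k ≤ A + T * ⌈∛ (n * k) ⌉ → A * ⌈∛ (n * k) ⌉ ≤ n * (D * D) → T ≤ Y → D ≤ Y →
            k ^ 3 ≤ 64 * Y ^ 3 * (n * k)
k^3-bound {n} {k} {A} {T} {D} k≤A+Tx Ax≤nD² T≤Y D≤Y with k ≤? 2 * A
... | yes k≤2A = ≤-trans
  (k^3-bound-manySurvivors {k} {A} {D} {⌈∛ (n * k) ⌉} k≤2A Ax≤nD² (≤⌈∛⌉^3 (n * k)))
  (*-monoˡ-≤ (n * k) (*-monoʳ-≤ 64 (^-monoˡ-≤ 3 D≤Y)))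
... | no  k≰2A = ≤-trans
  (k^3-bound-fewSurvivors {k} {A} {T} {⌈∛ (n * k) ⌉} k≤A+Tx k≰2A
    (⌈∛⌉^3≤8* (n * k) (>-nonZero⁻¹ (n * k) {{m*n≢0 n k}})))
  (*-monoˡ-≤ (n * k) (*-monoʳ-≤ 64 (^-monoˡ-≤ 3 T≤Y)))

-- Finite sums and subsets

sum-mono-≤ : ∀ {n} {f g : Vector ℕ n} → (∀ i → f i ≤ g i) → sum f ≤ sum g
sum-mono-≤ {zero}  f≤g = z≤n
sum-mono-≤ {suc n} f≤g = +-mono-≤ (f≤g zero) (sum-mono-≤ (f≤g ∘ suc))

≤-sum : ∀ {n} (f : Vector ℕ n) i → f i ≤ sum f
≤-sum f zero    = m≤m+n (f zero) _
≤-sum f (suc i) = ≤-trans (≤-sum (f ∘ suc) i) (m≤n+m _ (f zero))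

sum-≤-* : ∀ {n c} {f : Vector ℕ n} → (∀ i → f i ≤ c) → sum f ≤ n * c
sum-≤-* {zero}  f≤c = z≤n
sum-≤-* {suc n} f≤c = +-mono-≤ (f≤c zero) (sum-≤-* (f≤c ∘ suc))

χ : ∀ {n} → Subset n → Fin n → ℕ
χ p i = if lookup p i then 1 else 0

∣p∣≡∑χ : ∀ {n} (p : Subset n) → ∣ p ∣ ≡ sum (χ p)
∣p∣≡∑χ []            = refl
∣p∣≡∑χ (inside  ∷ p) = cong suc (∣p∣≡∑χ p)
∣p∣≡∑χ (outside ∷ p) = ∣p∣≡∑χ p

χ-∈ : ∀ {n} {p : Subset n} {i} → i ∈ p → χ p i ≡ 1
χ-∈ here       = refl
χ-∈ (there i∈p) = χ-∈ i∈p

χ-∉ : ∀ {n} {p : Subset n} {i} → i ∉ p → χ p i ≡ 0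
χ-∉ {p = inside  ∷ p} {zero}  i∉p = contradiction here i∉p
χ-∉ {p = outside ∷ p} {zero}  i∉p = refl
χ-∉ {p = _       ∷ p} {suc i} i∉p = χ-∉ (i∉p ∘ there)

union-bound : ∀ {n k} (C : Subset k) (F : Fin n → Subset k) (u : Fin n → ℕ) →
              (∀ l → l ∈ C → ∃ λ w → 1 ≤ u w × l ∈ F w) →
              ∣ C ∣ ≤ sum (λ w → u w * ∣ F w ∣)
union-bound C F u cover = begin
  ∣ C ∣                                   ≡⟨ ∣p∣≡∑χ C ⟩
  sum (χ C)                               ≤⟨ sum-mono-≤ χC≤ ⟩
  sum (λ l → sum (λ w → u w * χ (F w) l)) ≡⟨ ∑-comm (λ l w → u w * χ (F w) l) ⟩
  sum (λ w → sum (λ l → u w * χ (F w) l)) ≡⟨ sum-cong-≗ (λ w → sym (*-distribˡ-sum (u w) (χ (F w)))) ⟩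
  sum (λ w → u w * sum (χ (F w)))         ≡⟨ sum-cong-≗ (λ w → cong (u w *_) (sym (∣p∣≡∑χ (F w)))) ⟩
  sum (λ w → u w * ∣ F w ∣)               ∎
  where
  open ≤-Reasoning
  χC≤ : ∀ l → χ C l ≤ sum (λ w → u w * χ (F w) l)
  χC≤ l with l ∈? C
  ... | no  l∉C rewrite χ-∉ l∉C = z≤n
  ... | yes l∈C with cover l l∈C
  ...   | w , 1≤uw , l∈Fw = begin
    χ C l           ≡⟨ χ-∈ l∈C ⟩
    1               ≤⟨ 1≤uw ⟩
    u w             ≡⟨ sym (*-identityʳ (u w)) ⟩
    u w * 1         ≡⟨ cong (u w *_) (sym (χ-∈ l∈Fw)) ⟩
    u w * χ (F w) l ≤⟨ ≤-sum (λ w → u w * χ (F w) l) w ⟩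
    sum (λ w → u w * χ (F w) l) ∎

∣A∣*x≤n*[D*D] : ∀ {n k x D} (F : Fin n → Subset k) (A : Subset k) (C : Fin k → Subset k) →
                (∀ w → ∣ F w ∣ ≤ D) → (∀ j → j ∈ A → x ≤ ∣ C j ∣) →
                (∀ j → j ∈ A → ∀ l → l ∈ C j → ∃ λ w → j ∈ F w × l ∈ F w) →
                ∣ A ∣ * x ≤ n * (D * D)
∣A∣*x≤n*[D*D] {n} {x = x} {D} F A C F≤D x≤C share = begin
  ∣ A ∣ * x                                   ≡⟨ cong (_* x) (∣p∣≡∑χ A) ⟩
  sum (χ A) * x                               ≡⟨ *-distribʳ-sum x (χ A) ⟩
  sum (λ j → χ A j * x)                       ≤⟨ sum-mono-≤ χA*x≤ ⟩
  sum (λ j → sum (λ w → χ (F w) j * ∣ F w ∣)) ≡⟨ ∑-comm (λ j w → χ (F w) j * ∣ F w ∣) ⟩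
  sum (λ w → sum (λ j → χ (F w) j * ∣ F w ∣)) ≡⟨ sum-cong-≗ (λ w → sym (*-distribʳ-sum ∣ F w ∣ (χ (F w)))) ⟩
  sum (λ w → sum (χ (F w)) * ∣ F w ∣)         ≡⟨ sum-cong-≗ (λ w → cong (_* ∣ F w ∣) (sym (∣p∣≡∑χ (F w)))) ⟩
  sum (λ w → ∣ F w ∣ * ∣ F w ∣)               ≤⟨ sum-≤-* (λ w → *-mono-≤ (F≤D w) (F≤D w)) ⟩
  n * (D * D)                                 ∎
  where
  open ≤-Reasoning
  χA*x≤ : ∀ j → χ A j * x ≤ sum (λ w → χ (F w) j * ∣ F w ∣)
  χA*x≤ j with j ∈? A
  ... | no  j∉A rewrite χ-∉ j∉A = z≤n
  ... | yes j∈A rewrite χ-∈ j∈A | *-identityˡ x =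
    ≤-trans (x≤C j j∈A) (union-bound (C j) F (λ w → χ (F w) j) cover)
    where
    cover : ∀ l → l ∈ C j → ∃ λ w → 1 ≤ χ (F w) j × l ∈ F w
    cover l l∈Cj with share j j∈A l l∈Cj
    ... | w , j∈Fw , l∈Fw = w , ≤-reflexive (sym (χ-∈ j∈Fw)) , l∈Fw

x∈p─q⇒x∉q : ∀ {n} {p q : Subset n} {x} → x ∈ p ─ q → x ∉ q
x∈p─q⇒x∉q {p = _ ∷ p} {outside ∷ q} here           ()
x∈p─q⇒x∉q {p = _ ∷ p} {_       ∷ q} (there x∈p─q) (there x∈q) = x∈p─q⇒x∉q x∈p─q x∈q

∣p∪q∣≤∣p∣+∣q∣ : ∀ {n} (p q : Subset n) → ∣ p ∪ q ∣ ≤ ∣ p ∣ + ∣ q ∣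
∣p∪q∣≤∣p∣+∣q∣ []            []            = z≤n
∣p∪q∣≤∣p∣+∣q∣ (inside  ∷ p) (outside ∷ q) = s≤s (∣p∪q∣≤∣p∣+∣q∣ p q)
∣p∪q∣≤∣p∣+∣q∣ (inside  ∷ p) (inside  ∷ q) =
  s≤s (≤-trans (∣p∪q∣≤∣p∣+∣q∣ p q) (+-monoʳ-≤ ∣ p ∣ (n≤1+n ∣ q ∣)))
∣p∪q∣≤∣p∣+∣q∣ (outside ∷ p) (inside  ∷ q) =
  subst (suc ∣ p ∪ q ∣ ≤_) (sym (+-suc ∣ p ∣ ∣ q ∣)) (s≤s (∣p∪q∣≤∣p∣+∣q∣ p q))
∣p∪q∣≤∣p∣+∣q∣ (outside ∷ p) (outside ∷ q) = ∣p∪q∣≤∣p∣+∣q∣ p q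

∣p∣≤∣p─q∣+∣q∣ : ∀ {n} (p q : Subset n) → ∣ p ∣ ≤ ∣ p ─ q ∣ + ∣ q ∣
∣p∣≤∣p─q∣+∣q∣ []            []            = z≤n
∣p∣≤∣p─q∣+∣q∣ (inside  ∷ p) (outside ∷ q) = s≤s (∣p∣≤∣p─q∣+∣q∣ p q)
∣p∣≤∣p─q∣+∣q∣ (outside ∷ p) (outside ∷ q) = ∣p∣≤∣p─q∣+∣q∣ p q
∣p∣≤∣p─q∣+∣q∣ (inside  ∷ p) (inside  ∷ q) =
  subst (suc ∣ p ∣ ≤_) (sym (+-suc ∣ p ─ q ∣ ∣ q ∣)) (s≤s (∣p∣≤∣p─q∣+∣q∣ p q))
∣p∣≤∣p─q∣+∣q∣ (outside ∷ p) (inside  ∷ q) =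
  ≤-trans (∣p∣≤∣p─q∣+∣q∣ p q) (+-monoʳ-≤ ∣ p ─ q ∣ (n≤1+n ∣ q ∣))

x∉p⇒∣p∪⁅x⁆∣≡1+∣p∣ : ∀ {n} (p : Subset n) {x} → x ∉ p → ∣ p ∪ ⁅ x ⁆ ∣ ≡ suc ∣ p ∣
x∉p⇒∣p∪⁅x⁆∣≡1+∣p∣ (inside  ∷ p) {zero}  x∉p = contradiction here x∉p
x∉p⇒∣p∪⁅x⁆∣≡1+∣p∣ (outside ∷ p) {zero}  x∉p = cong (suc ∘ ∣_∣) (∪-identityʳ p)
x∉p⇒∣p∪⁅x⁆∣≡1+∣p∣ (inside  ∷ p) {suc x} x∉p = cong suc (x∉p⇒∣p∪⁅x⁆∣≡1+∣p∣ p (x∉p ∘ there))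
x∉p⇒∣p∪⁅x⁆∣≡1+∣p∣ (outside ∷ p) {suc x} x∉p = x∉p⇒∣p∪⁅x⁆∣≡1+∣p∣ p (x∉p ∘ there)

image : ∀ {q k} → (Fin q → Fin k) → Subset q → Subset k
image f []            = ⊥
image f (inside  ∷ S) = image (f ∘ suc) S ∪ ⁅ f zero ⁆
image f (outside ∷ S) = image (f ∘ suc) S

∈-image⁺ : ∀ {q k} (f : Fin q → Fin k) {S l} → l ∈ S → f l ∈ image f S
∈-image⁺ f {inside  ∷ S} here        = x∈p∪q⁺ (inj₂ (x∈⁅x⁆ (f zero)))
∈-image⁺ f {inside  ∷ S} (there l∈S) = x∈p∪q⁺ (inj₁ (∈-image⁺ (f ∘ suc) l∈S))
∈-image⁺ f {outside ∷ S} (there l∈S) = ∈-image⁺ (f ∘ suc) l∈S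

∈-image⁻ : ∀ {q k} (f : Fin q → Fin k) S {j} → j ∈ image f S → ∃ λ l → l ∈ S × f l ≡ j
∈-image⁻ f [] j∈ = contradiction j∈ ∉⊥
∈-image⁻ f (inside ∷ S) j∈ with x∈p∪q⁻ (image (f ∘ suc) S) ⁅ f zero ⁆ j∈
... | inj₁ j∈′ with ∈-image⁻ (f ∘ suc) S j∈′
...   | l , l∈S , refl = suc l , there l∈S , refl
∈-image⁻ f (inside ∷ S) j∈ | inj₂ j∈⁅f0⁆ = zero , here , sym (x∈⁅y⁆⇒x≡y (f zero) j∈⁅f0⁆)
∈-image⁻ f (outside ∷ S) j∈ with ∈-image⁻ (f ∘ suc) S j∈
... | l , l∈S , refl = suc l , there l∈S , refl

∣image∣≡∣∣ : ∀ {q k} (f : Fin q → Fin k) → Injective _≡_ _≡_ f → ∀ S → ∣ image f S ∣ ≡ ∣ S ∣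
∣image∣≡∣∣ {k = k} f inj [] = ∣⊥∣≡0 k
∣image∣≡∣∣ f inj (inside  ∷ S) = trans (x∉p⇒∣p∪⁅x⁆∣≡1+∣p∣ (image (f ∘ suc) S) f0∉)
                                      (cong suc (∣image∣≡∣∣ (f ∘ suc) (Fin.suc-injective ∘ inj) S))
  where
  f0∉ : f zero ∉ image (f ∘ suc) S
  f0∉ f0∈ with ∈-image⁻ (f ∘ suc) S f0∈
  ... | l , _ , fsl≡f0 with inj fsl≡f0
  ... | ()
∣image∣≡∣∣ f inj (outside ∷ S) = ∣image∣≡∣∣ (f ∘ suc) (Fin.suc-injective ∘ inj) S

toSubset : ∀ {n} {P : Fin n → Set} → Decidable P → Subset n
toSubset P? = tabulate (does ∘ P?)

∈-toSubset : ∀ {n} {P : Fin n → Set} (P? : Decidable P) {i} → (i ∈ toSubset P?) ⇔ P i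
∈-toSubset {P = P} P? {i} = from , to
  where
  from : i ∈ toSubset P? → P i
  from i∈ with P? i | trans (sym (lookup∘tabulate (does ∘ P?) i)) ([]=⇒lookup i∈)
  ... | yes Pi | _ = Pi
  to : P i → i ∈ toSubset P?
  to Pi = lookup⇒[]= i _ (trans (lookup∘tabulate (does ∘ P?) i) (dec-true (P? i) Pi))

-- Orienting edges of mixed graphs

module _ {n m : ℕ} where

  private variable
    G H H′ O : MixedGraph n m
    e : Fin m
    s t x y x′ y′ : Fin n
    p q ts : List (Trav n m)

  record IsArc (H : MixedGraph n m) (e : Fin m) (x y : Fin n) : Set where
    constructor arc
    field
      isDirected : directed H e ≡ true
      tail≡      : tail H e ≡ x
      head≡      : head H e ≡ y

  arc⇒step : IsArc H e x y → Step H e x y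
  arc⇒step (arc _ t≡x h≡y) = inj₁ (t≡x , h≡y)

  -- H arises from G by orienting some undirected edges.
  _⊑_ : MixedGraph n m → MixedGraph n m → Set
  H ⊑ G = ∀ {e x y} → Step H e x y → Step G e x y

  step-same-or-reversed : ∀ H → Step H e x y → Step H e x′ y′ →
                          (x ≡ x′ × y ≡ y′) ⊎ (x ≡ y′ × y ≡ x′)
  step-same-or-reversed _ (inj₁ (refl , refl)) (inj₁ (refl , refl))     = inj₁ (refl , refl)
  step-same-or-reversed _ (inj₁ (refl , refl)) (inj₂ (_ , refl , refl)) = inj₂ (refl , refl)
  step-same-or-reversed _ (inj₂ (_ , refl , refl)) (inj₁ (refl , refl)) = inj₂ (refl , refl)
  step-same-or-reversed _ (inj₂ (_ , refl , refl)) (inj₂ (_ , refl , refl)) = inj₁ (refl , refl)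

  walk-step : IsWalk G s t ts → (e , x , y) ∈ₗ ts → Step G e x y
  walk-step {ts = _ ∷ _}  (_ , st , _) (here refl) = st
  walk-step {G} {ts = _ ∷ ts} (_ , _ , w) (there tr∈) = walk-step {G} {ts = ts} w tr∈

  walk-map : ∀ ts → (∀ {e x y} → (e , x , y) ∈ₗ ts → Step G e x y → Step H e x y) →
             IsWalk G s t ts → IsWalk H s t ts
  walk-map []                f w               = w
  walk-map ((e , x , y) ∷ ts) f (s≡x , st , w) = s≡x , f (here refl) st , walk-map ts (f ∘′ there) w

  walk-source∈verts : IsWalk G s t ts → (e , x , y) ∈ₗ ts → x ∈ₗ verts s ts
  walk-source∈verts {ts = _ ∷ _}  (refl , _ , _) (here refl) = here refl
  walk-source∈verts {G} {ts = _ ∷ ts} (_ , _ , w) (there tr∈) = there (walk-source∈verts {G} {ts = ts} w tr∈)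

  step⇒arc : directed H e ≡ true → Step H e x y → IsArc H e x y
  step⇒arc d (inj₁ (t≡x , h≡y)) = arc d t≡x h≡y
  step⇒arc d (inj₂ (d′ , _))    = contradiction (trans (sym d) d′) λ ()

  arc-unique : IsArc H e x y → Step H e x′ y′ → x ≡ x′ × y ≡ y′
  arc-unique {H} (arc d t≡x h≡y) st with step⇒arc {H} d st
  ... | arc _ t≡x′ h≡y′ = trans (sym t≡x) t≡x′ , trans (sym h≡y) h≡y′

  orientation-keepsArc : IsOrientation H O → IsArc H e x y → IsArc O e x y
  orientation-keepsArc {e = e} io (arc d t≡x h≡y) with io e
  ... | dO , inj₁ (tO≡t , hO≡h) = arc dO (trans tO≡t t≡x) (trans hO≡h h≡y)
  ... | _  , inj₂ (d′ , _)       = contradiction (trans (sym d) d′) λ ()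

  record SameEdge (H H′ : MixedGraph n m) (e : Fin m) : Set where
    constructor same
    field
      tail≡     : tail H′ e ≡ tail H e
      head≡     : head H′ e ≡ head H e
      directed≡ : directed H′ e ≡ directed H e

  sameEdge-step : SameEdge H H′ e → Step H e x y → Step H′ e x y
  sameEdge-step (same t h _) (inj₁ (t≡x , h≡y))      = inj₁ (trans t t≡x , trans h h≡y)
  sameEdge-step (same t h d) (inj₂ (d′ , t≡y , h≡x)) = inj₂ (trans d d′ , trans t t≡y , trans h h≡x)

  sameEdge-sym : SameEdge H H′ e → SameEdge H′ H e
  sameEdge-sym (same t h d) = same (sym t) (sym h) (sym d)

  UndirectedOn : MixedGraph n m → List (Trav n m) → Fin m → Set
  UndirectedOn H p e = ∃ λ x → ∃ λ y → (e , x , y) ∈ₗ p × directed H e ≡ false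

  undirectedOn? : ∀ H p e → Dec (UndirectedOn H p e)
  undirectedOn? H p e with directed H e Bool.≟ false | any? (λ tr → proj₁ tr Fin.≟ e) p
  ... | no  d≢f | _     = no λ (_ , _ , _ , d) → d≢f d
  ... | yes _   | no e∉ = no λ (_ , _ , tr∈ , _) → e∉ (lose tr∈ refl)
  ... | yes d   | yes e∈ with find e∈
  ...   | (_ , x , y) , tr∈ , refl = yes (x , y , tr∈ , d)

  orientAlong-edge : OrientAlong H p H′ → ∀ e →
                     (∃₂ λ x y → (e , x , y) ∈ₗ p × directed H e ≡ false × IsArc H′ e x y)
                     ⊎ SameEdge H H′ e
  orientAlong-edge {H} {p} oa e with undirectedOn? H p e
  ... | yes (x , y , tr∈ , d) = let (t , h , d′) = proj₁ (oa e) x y tr∈ d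
                                in inj₁ (x , y , tr∈ , d , arc d′ t h)
  ... | no ¬u                 = let (t , h , d) = proj₂ (oa e) ¬u in inj₂ (same t h d)

  orientAlong-⊑ : OrientAlong H p H′ → IsWalk H s t p → H′ ⊑ H
  orientAlong-⊑ {H} oa w {e} st with orientAlong-edge oa e
  ... | inj₂ e-same = sameEdge-step (sameEdge-sym e-same) st
  ... | inj₁ (_ , _ , tr∈ , _ , e-arc) with arc-unique e-arc st
  ...   | refl , refl = walk-step w tr∈

  orientAlong-step : OrientAlong H p H′ → IsWalk H s t p → ¬ Conflict H p q →
                     (e , x , y) ∈ₗ q → Step H e x y → Step H′ e x y
  orientAlong-step {H} {e = e} oa w ¬conflict tr∈q st with orientAlong-edge oa e
  ... | inj₂ e-same = sameEdge-step e-same st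
  ... | inj₁ (x₀ , y₀ , tr∈p , d , e-arc) with step-same-or-reversed H st (walk-step w tr∈p)
  ...   | inj₁ (refl , refl) = arc⇒step e-arc
  ...   | inj₂ (refl , refl) = contradiction (e , x₀ , y₀ , d , tr∈p , tr∈q) ¬conflict

  orientAlong-keepsArc : OrientAlong H p H′ → IsArc H e x y → IsArc H′ e x y
  orientAlong-keepsArc {e = e} oa (arc d t≡x h≡y) with orientAlong-edge oa e
  ... | inj₁ (_ , _ , _ , d′ , _) = contradiction (trans (sym d) d′) λ ()
  ... | inj₂ e-same@(same _ _ d′) = step⇒arc (trans d′ d) (sameEdge-step e-same (inj₁ (t≡x , h≡y)))

  orientAlong-arc : OrientAlong H p H′ → IsWalk H s t p → (e , x , y) ∈ₗ p → IsArc H′ e x y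
  orientAlong-arc {H} {e = e} oa w tr∈ with directed H e in d
  ... | false = let (t , h , d′) = proj₁ (oa e) _ _ tr∈ d in arc d′ t h
  ... | true  = orientAlong-keepsArc oa (step⇒arc d (walk-step w tr∈))

  ⊑-acyclic : H ⊑ G → Acyclic G → Acyclic H
  ⊑-acyclic H⊑G acyclic x ts (ne , w , u₁ , u₂) = acyclic x ts (ne , walk-map ts (λ _ → H⊑G) w , u₁ , u₂)

  ⊑-shortestPath : H ⊑ G → IsWalk H s t p → IsShortestPath G (s , t) p → IsShortestPath H (s , t) p
  ⊑-shortestPath H⊑G w ((_ , u) , shortest) =
    (w , u) , λ ts (w′ , u′) → shortest ts (walk-map ts (λ _ → H⊑G) w′ , u′)

  traversal-target∈verts : (e , x , y) ∈ₗ ts → y ∈ₗ verts s ts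
  traversal-target∈verts tr∈ = there (∈-map⁺ trTo tr∈)

  AllArcs : MixedGraph n m → List (Trav n m) → Set
  AllArcs H p = ∀ {e x y} → (e , x , y) ∈ₗ p → IsArc H e x y

  allArcs-path : AllArcs O p → IsPath G s t p → IsPath O s t p
  allArcs-path {p = p} arcs (w , u) = walk-map p (λ tr∈ _ → arc⇒step (arcs tr∈)) w , u

  conflict? : (H : MixedGraph n m) (p q : List (Trav n m)) → Dec (Conflict H p q)
  conflict? H p q with any? (λ (e , x , y) → (directed H e Bool.≟ false) ×-dec ((e , y , x) ∈ₜ? q)) p
    where open DecMembership (≡-dec Fin._≟_ (≡-dec Fin._≟_ Fin._≟_)) using () renaming (_∈?_ to _∈ₜ?_)
  ... | yes tr∈ with find tr∈
  ...   | (e , x , y) , tr∈p , d , tr∈q = yes (e , x , y , d , tr∈p , tr∈q)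
  conflict? H p q | no ¬any = no λ (e , x , y , d , tr∈p , tr∈q) → ¬any (lose tr∈p (d , tr∈q))

-- Invariants of the greedy loop

module _ {n m k : ℕ} (req : Fin k → Request n) (paths : Fin k → List (Trav n m)) where

  open Greedy req paths
  open DecMembership (Fin._≟_ {n}) using () renaming (_∈?_ to _∈ᵥ?_)

  private variable
    H H′ Hf : MixedGraph n m
    A Af C : Subset k
    i : Fin k

  WalksIn : MixedGraph n m → Subset k → Set
  WalksIn H A = ∀ j → j ∈ A → IsWalk H (proj₁ (req j)) (proj₂ (req j)) (paths j)

  orientStep-walks : i ∈ A → IsConflictSet H A i C → OrientAlong H (paths i) H′ →
                     WalksIn H A → WalksIn H′ (A ─ (C ∪ ⁅ i ⁆))
  orientStep-walks {i = i} {A = A} {H = H} {C = C} i∈A isC orient walks j j∈A′ =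
    walk-map (paths j) (orientAlong-step orient (walks i i∈A) ¬conflict) (walks j j∈A)
    where
    j∈A : j ∈ A
    j∈A = p─q⊆p A (C ∪ ⁅ i ⁆) j∈A′
    ¬conflict : ¬ Conflict H (paths i) (paths j)
    ¬conflict c = x∈p─q⇒x∉q j∈A′ (x∈p∪q⁺ (inj₁ (proj₂ (isC j) (j∈A , c))))

  loop-walks : Loop H A Hf Af → WalksIn H A → WalksIn Hf Af
  loop-walks (done _) walks = walks
  loop-walks (step i C H′ i∈A isC _ orient rest) walks =
    loop-walks rest (orientStep-walks i∈A isC orient walks)

  loop-⊑ : Loop H A Hf Af → WalksIn H A → Hf ⊑ H
  loop-⊑ (done _) _ st = st
  loop-⊑ (step i C H′ i∈A isC _ orient rest) walks st =
    orientAlong-⊑ orient (walks i i∈A) (loop-⊑ rest (orientStep-walks i∈A isC orient walks) st)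

  loop-keepsArc : ∀ {e x y} → Loop H A Hf Af → IsArc H e x y → IsArc Hf e x y
  loop-keepsArc (done _) a = a
  loop-keepsArc (step _ _ _ _ _ _ orient rest) a = loop-keepsArc rest (orientAlong-keepsArc orient a)

  loop-stable : Loop H A Hf Af → ∀ j C → j ∈ Af → IsConflictSet Hf Af j C → n * k ≤ ∣ C ∣ ^ 3
  loop-stable (done stable) j C j∈ isC = ≮⇒≥ (stable j C j∈ isC)
  loop-stable (step _ _ _ _ _ _ _ rest) = loop-stable rest

  loop-oriented : Loop H A Hf Af → WalksIn H A →
                  Σ (Subset k) λ T → T ⊆ A × (∀ j → j ∈ T → AllArcs Hf (paths j))
                                     × ∣ A ∣ ≤ ∣ Af ∣ + ∣ T ∣ * ⌈∛ (n * k) ⌉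
  loop-oriented {A = A} (done _) _ =
    ⊥ , (λ j∈⊥ → contradiction j∈⊥ ∉⊥) , (λ _ j∈⊥ → contradiction j∈⊥ ∉⊥) ,
    subst (λ c → ∣ A ∣ ≤ ∣ A ∣ + c * ⌈∛ (n * k) ⌉) (sym (∣⊥∣≡0 k)) (m≤m+n ∣ A ∣ 0)
  loop-oriented {A = A} {Af = Af} (step i C H′ i∈A isC small orient rest) walks
    with loop-oriented rest (orientStep-walks i∈A isC orient walks)
  ... | T , T⊆A′ , arcsT , countT = T ∪ ⁅ i ⁆ , T∪i⊆A , arcs , count
    where
    x = ⌈∛ (n * k) ⌉
    A′ = A ─ (C ∪ ⁅ i ⁆)
    T∪i⊆A : T ∪ ⁅ i ⁆ ⊆ A
    T∪i⊆A j∈ with x∈p∪q⁻ T ⁅ i ⁆ j∈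
    ... | inj₁ j∈T  = p─q⊆p A (C ∪ ⁅ i ⁆) (T⊆A′ j∈T)
    ... | inj₂ j∈⁅i⁆ rewrite x∈⁅y⁆⇒x≡y i j∈⁅i⁆ = i∈A
    arcs : ∀ j → j ∈ T ∪ ⁅ i ⁆ → AllArcs _ (paths j)
    arcs j j∈ with x∈p∪q⁻ T ⁅ i ⁆ j∈
    ... | inj₁ j∈T  = arcsT j j∈T
    ... | inj₂ j∈⁅i⁆ rewrite x∈⁅y⁆⇒x≡y i j∈⁅i⁆ =
      λ tr∈ → loop-keepsArc rest (orientAlong-arc orient (walks i i∈A) tr∈)
    i∉T : i ∉ T
    i∉T i∈T = x∈p─q⇒x∉q (T⊆A′ i∈T) (x∈p∪q⁺ (inj₂ (x∈⁅x⁆ i)))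
    removed≤x : ∣ C ∪ ⁅ i ⁆ ∣ ≤ x
    removed≤x = begin
      ∣ C ∪ ⁅ i ⁆ ∣     ≤⟨ ∣p∪q∣≤∣p∣+∣q∣ C ⁅ i ⁆ ⟩
      ∣ C ∣ + ∣ ⁅ i ⁆ ∣ ≡⟨ cong (∣ C ∣ +_) (∣⁅x⁆∣≡1 i) ⟩
      ∣ C ∣ + 1         ≡⟨ +-comm ∣ C ∣ 1 ⟩
      suc ∣ C ∣         ≤⟨ <⌈∛⌉ small ⟩
      x                 ∎
      where open ≤-Reasoning
    count : ∣ A ∣ ≤ ∣ Af ∣ + ∣ T ∪ ⁅ i ⁆ ∣ * x
    count = begin
      ∣ A ∣                          ≤⟨ ∣p∣≤∣p─q∣+∣q∣ A (C ∪ ⁅ i ⁆) ⟩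
      ∣ A′ ∣ + ∣ C ∪ ⁅ i ⁆ ∣          ≤⟨ +-mono-≤ countT removed≤x ⟩
      ∣ Af ∣ + ∣ T ∣ * x + x          ≡⟨ +-assoc ∣ Af ∣ (∣ T ∣ * x) x ⟩
      ∣ Af ∣ + (∣ T ∣ * x + x)        ≡⟨ cong (∣ Af ∣ +_) (+-comm (∣ T ∣ * x) x) ⟩
      ∣ Af ∣ + suc ∣ T ∣ * x          ≡⟨ cong (λ c → ∣ Af ∣ + c * x) (sym (x∉p⇒∣p∪⁅x⁆∣≡1+∣p∣ T i∉T)) ⟩
      ∣ Af ∣ + ∣ T ∪ ⁅ i ⁆ ∣ * x      ∎
      where open ≤-Reasoning

  loop-survivors : ∀ {D} → Loop H A Hf Af → WalksIn H A →
                   (∀ w Pw → IsThrough Af w Pw → ∣ Pw ∣ ≤ D) →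
                   ∣ Af ∣ * ⌈∛ (n * k) ⌉ ≤ n * (D * D)
  loop-survivors {Hf = Hf} {Af = Af} loop walks load≤D =
    ∣A∣*x≤n*[D*D] through Af conflicts (λ w → load≤D w (through w) (λ j → ∈-toSubset (through? w)))
      (λ j j∈ → ⌈∛⌉-least (loop-stable loop j (conflicts j) j∈ (λ l → ∈-toSubset (conflicts? j))))
      share
    where
    vertices : Fin k → List (Fin n)
    vertices j = verts (proj₁ (req j)) (paths j)
    through? : ∀ w j → Dec (j ∈ Af × w ∈ₗ vertices j)
    through? w j = (j ∈? Af) ×-dec (w ∈ᵥ? vertices j)
    through : Fin n → Subset k
    through w = toSubset (through? w)
    conflicts? : ∀ j l → Dec (l ∈ Af × Conflict Hf (paths j) (paths l))
    conflicts? j l = (l ∈? Af) ×-dec conflict? Hf (paths j) (paths l)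
    conflicts : Fin k → Subset k
    conflicts j = toSubset (conflicts? j)
    share : ∀ j → j ∈ Af → ∀ l → l ∈ conflicts j → ∃ λ w → j ∈ through w × l ∈ through w
    share j j∈ l l∈ with proj₁ (∈-toSubset (conflicts? j)) l∈
    ... | l∈Af , (_ , x , y , _ , tr∈j , tr∈l) =
      x , proj₂ (∈-toSubset (through? x)) (j∈ , walk-source∈verts (loop-walks loop walks j j∈) tr∈j)
        , proj₂ (∈-toSubset (through? x)) (l∈Af , traversal-target∈verts tr∈l)

-- Analysis of the returned orientation

module _ {n m k a b : ℕ} .{{_ : NonZero n}} .{{_ : NonZero k}} .{{_ : NonZero a}} .{{_ : NonZero b}}
         {𝒜 : AlgA n m} (spec : AlgSpec a b 𝒜)
         {G : MixedGraph n m} (acyclic : Acyclic G)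
         {req : Fin k → Request n} (req-inj : Injective _≡_ _≡_ req)
         {paths : Fin k → List (Trav n m)} (shortest : ∀ i → IsShortestPath G (req i) (paths i))
         {Hf : MixedGraph n m} {Af : Subset k} (loop : Greedy.Loop req paths G ⊤ Hf Af)
         {v : Fin n} {Pv : Subset k} (Pv-through : Greedy.IsThrough req paths Af v Pv)
         (Pv-max : ∀ w Pw → Greedy.IsThrough req paths Af w Pw → ∣ Pw ∣ ≤ ∣ Pv ∣)
         {q : ℕ} {enum : Fin q → Fin k} (enum-inj : Injective _≡_ _≡_ enum)
         (enum-onto : ∀ j → (j ∈ Pv) ⇔ (∃ λ l → enum l ≡ j)) where

  private
    walks₀ : WalksIn req paths G ⊤
    walks₀ j _ = proj₁ (proj₁ (shortest j))

    Hf⊑G : Hf ⊑ G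
    Hf⊑G = loop-⊑ req paths loop walks₀

    Q : Fin q → Request n × List (Trav n m)
    Q l = req (enum l) , paths (enum l)

    Q-spec : ∀ l → IsShortestPath Hf (proj₁ (Q l)) (proj₂ (Q l))
                   × v ∈ₗ verts (proj₁ (proj₁ (Q l))) (proj₂ (Q l))
    Q-spec l = ⊑-shortestPath Hf⊑G (loop-walks req paths loop walks₀ (enum l) (proj₁ enum-l-through))
                              (shortest (enum l))
             , proj₂ enum-l-through
      where
      enum-l-through : enum l ∈ Af × v ∈ₗ verts (proj₁ (req (enum l))) (paths (enum l))
      enum-l-through = proj₁ (Pv-through (enum l)) (proj₂ (enum-onto (enum l)) (l , refl))

    O : MixedGraph n m
    O = 𝒜 Hf v q Q

    𝒜-guarantee : IsOrientation Hf O × Σ (Subset q) λ SA →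
                  (∀ l → l ∈ SA → Satisfies O (req (enum l))) × a * q ≤ b * ∣ SA ∣
    𝒜-guarantee = spec Hf v q Q (⊑-acyclic Hf⊑G acyclic) (enum-inj ∘ req-inj) Q-spec

    SA : Subset q
    SA = proj₁ (proj₂ 𝒜-guarantee)

    oriented : Σ (Subset k) λ T → T ⊆ ⊤ × (∀ j → j ∈ T → AllArcs Hf (paths j))
                                 × ∣ ⊤ {k} ∣ ≤ ∣ Af ∣ + ∣ T ∣ * ⌈∛ (n * k) ⌉
    oriented = loop-oriented req paths loop walks₀

    T : Subset k
    T = proj₁ oriented

    S : Subset k
    S = T ∪ image enum SA

    S-satisfied : ∀ i → i ∈ S → Satisfies O (req i)
    S-satisfied i i∈S with x∈p∪q⁻ T (image enum SA) i∈S
    ... | inj₁ i∈T =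
      paths i , allArcs-path (orientation-keepsArc (proj₁ 𝒜-guarantee) ∘ Hf-arcs) (proj₁ (shortest i))
      where
      Hf-arcs : AllArcs Hf (paths i)
      Hf-arcs = proj₁ (proj₂ (proj₂ oriented)) i i∈T
    ... | inj₂ i∈image with ∈-image⁻ enum SA i∈image
    ...   | l , l∈SA , refl = proj₁ (proj₂ (proj₂ 𝒜-guarantee)) l l∈SA

    k≤∣Af∣+∣T∣*x : k ≤ ∣ Af ∣ + ∣ T ∣ * ⌈∛ (n * k) ⌉
    k≤∣Af∣+∣T∣*x = subst (_≤ ∣ Af ∣ + ∣ T ∣ * ⌈∛ (n * k) ⌉) (∣⊤∣≡n k) (proj₂ (proj₂ (proj₂ oriented)))

    ∣T∣≤b*∣S∣ : ∣ T ∣ ≤ b * ∣ S ∣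
    ∣T∣≤b*∣S∣ = ≤-trans (∣p∣≤∣p∪q∣ T (image enum SA)) (m≤n*m ∣ S ∣ b)

    ∣Pv∣≤b*∣S∣ : ∣ Pv ∣ ≤ b * ∣ S ∣
    ∣Pv∣≤b*∣S∣ = begin
      ∣ Pv ∣                ≤⟨ p⊆q⇒∣p∣≤∣q∣ Pv⊆image ⟩
      ∣ image enum ⊤ ∣      ≡⟨ ∣image∣≡∣∣ enum enum-inj ⊤ ⟩
      ∣ ⊤ {q} ∣             ≡⟨ ∣⊤∣≡n q ⟩
      q                     ≤⟨ m≤n*m q a ⟩
      a * q                 ≤⟨ proj₂ (proj₂ (proj₂ 𝒜-guarantee)) ⟩
      b * ∣ SA ∣            ≡⟨ cong (b *_) (sym (∣image∣≡∣∣ enum enum-inj SA)) ⟩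
      b * ∣ image enum SA ∣ ≤⟨ *-monoʳ-≤ b (∣q∣≤∣p∪q∣ T (image enum SA)) ⟩
      b * ∣ S ∣             ∎
      where
      open ≤-Reasoning
      Pv⊆image : ∀ {j} → j ∈ Pv → j ∈ image enum ⊤
      Pv⊆image {j} j∈Pv with proj₁ (enum-onto j) j∈Pv
      ... | l , refl = ∈-image⁺ enum ∈⊤

  greedy-guarantee : Σ (Subset k) λ S →
                     (∀ i → i ∈ S → Satisfies (𝒜 Hf v q (λ l → req (enum l) , paths (enum l))) (req i))
                     × k ^ 3 ≤ 64 * b ^ 3 * ∣ S ∣ ^ 3 * n * k
  greedy-guarantee = S , S-satisfied , (begin
    k ^ 3                          ≤⟨ k^3-bound k≤∣Af∣+∣T∣*x (loop-survivors req paths loop walks₀ Pv-max)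
                                                ∣T∣≤b*∣S∣ ∣Pv∣≤b*∣S∣ ⟩
    64 * (b * ∣ S ∣) ^ 3 * (n * k) ≡⟨ regroup b ∣ S ∣ n k ⟩
    64 * b ^ 3 * ∣ S ∣ ^ 3 * n * k ∎)
    where
    open ≤-Reasoning
    regroup : ∀ b s n k → 64 * ((b * s) * ((b * s) * ((b * s) * 1))) * (n * k)
                          ≡ 64 * (b * (b * (b * 1))) * (s * (s * (s * 1))) * n * k
    regroup = solve-∀

theorem6 : (a b : ℕ) → 0 < a → 0 < b → Σ ℕ λ d →
    ∀ {n m} (𝒜 : AlgA n m) → AlgSpec a b 𝒜 →
    (G : MixedGraph n m) → Simple G → Acyclic G →
    (k : ℕ) (req : Fin k → Request n) → Injective _≡_ _≡_ req →
    (∀ i → ∃ λ ts → IsPath G (proj₁ (req i)) (proj₂ (req i)) ts) →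
    (paths : Fin k → List (Trav n m)) → (∀ i → IsShortestPath G (req i) (paths i)) →
    ∀ Hf Af → Greedy.Loop req paths G ⊤ Hf Af →
    (v : Fin n) (Pv : Subset k) → Greedy.IsThrough req paths Af v Pv →
    (∀ w Pw → Greedy.IsThrough req paths Af w Pw → ∣ Pw ∣ ≤ ∣ Pv ∣) →
    (q : ℕ) (enum : Fin q → Fin k) → Injective _≡_ _≡_ enum →
    (∀ j → (j ∈ Pv) ⇔ (∃ λ l → enum l ≡ j)) →
    Σ (Subset k) λ S →
      (∀ i → i ∈ S →
        Satisfies (𝒜 Hf v q (λ l → req (enum l) , paths (enum l))) (req i))
      × k ^ 3 ≤ d * ∣ S ∣ ^ 3 * n * k
theorem6 a b 0<a 0<b = 64 * b ^ 3 , λ where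
  _ _ _ _ _ zero _ _ _ _ _ _ _ _ _ _ _ _ _ _ _ _ → [] , (λ ()) , z≤n
  _ spec _ _ acyclic (suc _) req req-inj _ _ shortest _ _ loop _ _ Pv-through Pv-max _ _ enum-inj enum-onto →
    greedy-guarantee {{Fin.nonZeroIndex (proj₁ (req zero))}} {{_}} {{>-nonZero 0<a}} {{>-nonZero 0<b}}
      spec acyclic req-inj shortest loop Pv-through Pv-max enum-inj enum-onto
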